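{- Let $G$ be an $r$-cop-win graph ($r\in\{0,1\}$) of finite corner rank $\alpha\ge2$. Every Catching strategy on $G$ is also a Lower Way strategy.
   Context: All graphs are finite, nonempty and reflexive (every vertex adjacent to itself). For distinct vertices $v,w$ of a graph $H$: $w$ corners $v$ in $H$ if every vertex of $H$ adjacent to $v$ is adjacent to $w$; strictly corners if moreover some vertex of $H$ adjacent to $w$ is not adjacent to $v$; a strict corner of $H$ is a vertex strictly cornered in $H$ by another vertex. We also say $c$ corners $x$ in $H$ when $c=x$. Corner ranking: $G_1=G$, $k=1$. If $G_k$ is a clique, its vertices get rank $k$; stop. Else if $G_k$ has no strict corners, its vertices get rank $\infty$; stop. Else the set $X$ of strict corners of $G_k$ gets rank $k$, $G_{k+1}=G_k-X$, increase $k$, repeat. $\mathrm{cr}(v)$ is the rank of $v$, $\mathrm{cr}(G)$ the maximum rank. For finite corner rank $\alpha\ge2$: $G$ is $1$-cop-win if some (equivalently every) vertex of rank $\alpha$ is adjacent to all vertices of $G_{\alpha-1}$, otherwise $0$-cop-win. Projections: $f_k(\{u\})=\{u\}$ if $\mathrm{cr}(u)>k$, otherwise the set of vertices of $G_{k+1}$ that strictly corner $u$ in $G_k$; $f_k(S)=\bigcup_{u\in S}f_k(\{u\})$; $F_1$ the identity, $F_k=f_{k-1}\circ\cdots\circ f_1$, $F_k(v)=F_k(\{v\})$. Game: cop places, robber places, then alternate moves with the cop first; a move is staying or moving to an adjacent vertex; the cop wins when both share a vertex. With the cop at $c$ and robber at $x$: $x$ is $0$-cornered if $c=x$; for $k\ge1$,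 $x$ is $k$-cornered by $c$ if some $x'\in F_k(x)$ is cornered by $c$ in the subgraph induced by $V(G_k)\cup\{c\}$; the cop has $k$-caught the robber ($k\ge1$) if $c\in F_k(x)$. A standard initial placement is a vertex adjacent to every vertex of $G_{\alpha-r}$. Lower Way strategy: standard initial placement and, for every $t\ge1$, after $t$ cop moves the cop $k$-corners the robber for some $k\le\alpha-r-t$. Catching strategy: standard initial placement and, for every $t\ge1$, after $t$ cop moves the cop has $k$-caught the robber for some $k\le\alpha-r-t+1$. -}

module Defs where

open import Data.Nat using (ℕ; zero; suc; _+_; _∸_; _≤_; _<_)
open import Data.Fin using (Fin)
open import Data.Bool using (Bool; true)
open import Data.List using (List; []; _++_; [_])
open import Data.Product using (_×_; _,_; ∃)
open import Data.Sum using (_⊎_)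
open import Data.Unit using (⊤)
open import Relation.Nullary using (¬_)
open import Relation.Binary.PropositionalEquality using (_≡_; _≢_)

record Graph : Set where
  field
    n        : ℕ
    nonempty : 1 ≤ n
    adj      : Fin n → Fin n → Bool
    adj-refl : ∀ v → adj v v ≡ true
    adj-sym  : ∀ u v → adj u v ≡ adj v u

module _ (G : Graph) where
  open Graph G

  V : Set
  V = Fin n

  Adj : V → V → Set
  Adj u v = adj u v ≡ true

  -- vertex sets (induced subgraphs are given by their vertex sets)
  VSet : Set₁
  VSet = V → Set

  Corners : VSet → V → V → Set
  Corners H w v = H w × H v × w ≢ v × (∀ y → H y → Adj y v → Adj y w)

  StrictlyCorners : VSet → V → V → Set
  StrictlyCorners H w v = Corners H w v × ∃ (λ y → H y × Adj y w × ¬ Adj y v)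

  StrictCorner : VSet → V → Set
  StrictCorner H v = ∃ (λ w → StrictlyCorners H w v)

  Clique : VSet → Set
  Clique H = ∀ u v → H u → H v → Adj u v

  -- G' j = G_{j+1}: remove all strict corners at each step
  G' : ℕ → VSet
  G' zero v = ⊤
  G' (suc j) v = G' j v × ¬ StrictCorner (G' j) v

  -- G_k for k ≥ 1 (G_0 is an unused dummy equal to G_1)
  Gk : ℕ → VSet
  Gk k = G' (k ∸ 1)

  -- the ranking procedure reaches stage k (it did not stop at any j < k)
  Active : ℕ → Set
  Active k = ∀ j → 1 ≤ j → j < k → ¬ Clique (Gk j) × ∃ (λ v → StrictCorner (Gk j) v)

  HasRank : V → ℕ → Set
  HasRank v k = 1 ≤ k × Active k ×
    ((Clique (Gk k) × Gk k v) ⊎ (¬ Clique (Gk k) × StrictCorner (Gk k) v))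

  -- cr(v) > k (this includes cr(v) = ∞)
  RankGT : V → ℕ → Set
  RankGT v k = ∀ j → HasRank v j → k < j

  FiniteCornerRank : ℕ → Set
  FiniteCornerRank α = (∀ v → ∃ (λ k → HasRank v k)) × ∃ (λ v → HasRank v α)
                       × (∀ v k → HasRank v k → k ≤ α)

  OneCopWinCond : ℕ → Set
  OneCopWinCond α = ∃ (λ v → HasRank v α × (∀ y → Gk (α ∸ 1) y → Adj v y))

  RCopWin : ℕ → ℕ → Set
  RCopWin α r = (r ≡ 1 × OneCopWinCond α) ⊎ (r ≡ 0 × ¬ OneCopWinCond α)

  f : ℕ → VSet → VSet
  f k S y = ∃ λ u → S u × ((RankGT u k × y ≡ u)
              ⊎ (¬ RankGT u k × Gk (suc k) y × StrictlyCorners (Gk k) y u))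

  F' : ℕ → V → VSet
  F' zero x y = y ≡ x
  F' (suc j) x = f (suc j) (F' j x)

  -- F_k(x), k ≥ 1 (F_1 = identity)
  F : ℕ → V → VSet
  F k = F' (k ∸ 1)

  CornersOrEq : VSet → V → V → Set
  CornersOrEq H c x = c ≡ x ⊎ Corners H c x

  KCornered : ℕ → V → V → Set
  KCornered zero c x = c ≡ x
  KCornered (suc j) c x =
    ∃ λ x' → F (suc j) x x' × CornersOrEq (λ y → Gk (suc j) y ⊎ y ≡ c) c x'

  KCaught : ℕ → V → V → Set
  KCaught k c x = F k x c

  -- A cop strategy maps the history [(c_0,x_0),…,(c_{t-1},x_{t-1})]
  -- to the next cop position c_t; on the empty history it gives the
  -- initial placement c_0.  A robber play is a sequence x_0, x_1, …
  -- (x_i = robber position after its i-th move; x_0 its placement).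
  Strategy : Set
  Strategy = List (V × V) → V

  Robber : Set
  Robber = ℕ → V

  LegalRobber : Robber → Set
  LegalRobber ρ = ∀ i → Adj (ρ i) (ρ (suc i))

  hist : Strategy → Robber → ℕ → List (V × V)
  hist σ ρ zero = []
  hist σ ρ (suc t) = hist σ ρ t ++ [ (σ (hist σ ρ t) , ρ t) ]

  cop : Strategy → Robber → ℕ → V
  cop σ ρ t = σ (hist σ ρ t)

  -- the game has not ended before the cop's (s+1)-th move
  Ongoing : Strategy → Robber → ℕ → Set
  Ongoing σ ρ s = (∀ i → i ≤ s → cop σ ρ i ≢ ρ i)
                × (∀ i → i < s → cop σ ρ (suc i) ≢ ρ i)

  LegalStrategy : Strategy → Set
  LegalStrategy σ = ∀ ρ → LegalRobber ρ → ∀ s → Ongoing σ ρ s →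
                    Adj (cop σ ρ s) (cop σ ρ (suc s))

  StandardInitial : ℕ → ℕ → Strategy → Set
  StandardInitial α r σ = ∀ y → Gk (α ∸ r) y → Adj (σ []) y

  -- after t = s+1 cop moves: cop at c_{s+1}, robber at x_s.
  -- Lower Way: some k ≥ 0 with k ≤ α - r - t  (written k + t + r ≤ α)
  LowerWay : ℕ → ℕ → Strategy → Set
  LowerWay α r σ = StandardInitial α r σ ×
    (∀ ρ → LegalRobber ρ → ∀ s → Ongoing σ ρ s →
       ∃ λ k → k + suc s + r ≤ α × KCornered k (cop σ ρ (suc s)) (ρ s))

  -- Catching: some k ≥ 1 with k ≤ α - r - t + 1  (written k + t + r ≤ α + 1)
  Catching : ℕ → ℕ → Strategy → Set
  Catching α r σ = StandardInitial α r σ ×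
    (∀ ρ → LegalRobber ρ → ∀ s → Ongoing σ ρ s →
       ∃ λ k → 1 ≤ k × k + suc s + r ≤ suc α × KCaught k (cop σ ρ (suc s)) (ρ s))

module Submission where

open import Defs
open import Data.Nat using (ℕ; zero; suc; _+_; _≤_)
open import Data.Nat.Properties using (≤-pred)
open import Data.Product using (_×_; _,_; ∃)
open import Data.Sum using (_⊎_; inj₁; inj₂)
open import Relation.Binary.PropositionalEquality using (_≡_; refl)

-- If the cop has (k+1)-caught the robber at x, its position c lies in
-- f_k(u) for some u ∈ F_k(x): either c = u, or c strictly corners u in G_k.
-- Either way u witnesses that x is k-cornered by c, so the Catching bound
-- k + 1 ≤ α − r − t + 1 is exactly the Lower Way bound k ≤ α − r − t.

module _ (G : Graph) where

  corners-with-cornerer : ∀ {H c u} → Corners G H c u →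
                          Corners G (λ y → H y ⊎ y ≡ c) c u
  corners-with-cornerer (Hc , Hu , c≢u , nbrs) =
    inj₁ Hc , inj₁ Hu , c≢u , λ where
      y (inj₁ Hy)   yu → nbrs y Hy yu
      y (inj₂ refl) _  → Graph.adj-refl G y

  caught⇒cornered : ∀ k {c x} → KCaught G (suc k) c x → KCornered G k c x
  caught⇒cornered zero    c≡x                                  = c≡x
  caught⇒cornered (suc k) (u , u∈F , inj₁ (_ , refl))          = u , u∈F , inj₁ refl
  caught⇒cornered (suc k) (u , u∈F , inj₂ (_ , _ , corner , _)) =
    u , u∈F , inj₂ (corners-with-cornerer corner)

lemma4p11 : (G : Graph) (α r : ℕ) → r ≤ 1 → 2 ≤ α →
    FiniteCornerRank G α → RCopWin G α r →
    (σ : Strategy G) → LegalStrategy G σ →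
    Catching G α r σ → LowerWay G α r σ
lemma4p11 G α r _ _ _ _ σ _ (standard , catching) = standard , lowerWay
  where
  lowerWay : ∀ ρ → LegalRobber G ρ → ∀ s → Ongoing G σ ρ s →
             ∃ λ k → k + suc s + r ≤ α × KCornered G k (cop G σ ρ (suc s)) (ρ s)
  lowerWay ρ legal s ongoing with catching ρ legal s ongoing
  ... | suc k , _ , bound , caught = k , ≤-pred bound , caught⇒cornered G k caught
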